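{- Let $p$ be an odd prime, let $m\ge 2$ and $1\le l\le m-1$ be integers with $\gcd(m,l)>1$, and let $q=p^m$. Let $\mathcal{D}$ be the $\mathbb{F}_p$-linear code of length $p^m$ with coordinates indexed by $\mathbb{F}_q$ given by $\mathcal{D}=\{(\mathrm{Tr}(ax^{p^l+1}+bx)+h)_{x\in\mathbb{F}_q} : a,b\in\mathbb{F}_q,\ h\in\mathbb{F}_p\}$ if $l\ne m/2$, and $\mathcal{D}=\{(\mathrm{Tr}(ax^{p^{m/2}+1}+bx)+h)_{x\in\mathbb{F}_q} : a\in\mathbb{F}_{p^{m/2}},\ b\in\mathbb{F}_q,\ h\in\mathbb{F}_p\}$ if $l=m/2$. For each integer $i\ge 1$ such that $\mathcal{D}$ has at least one codeword of Hamming weight $i$, let $\mathcal{B}_i$ be the set of supports $\{x\in\mathbb{F}_q : c_x\neq 0\}$ of all codewords $c\in\mathcal{D}$ of weight $i$. Then $(\mathbb{F}_q,\mathcal{B}_i)$ is a $2$-design.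
   Context: $\mathrm{Tr}$ is the absolute trace from $\mathbb{F}_q$ to $\mathbb{F}_p$. A $2$-$(v,k,\lambda)$ design is a pair $(\mathcal{P},\mathcal{B})$ where $\mathcal{P}$ is a set of $v$ points and $\mathcal{B}$ is a set of $k$-subsets of $\mathcal{P}$ (blocks) such that every $2$-subset of $\mathcal{P}$ is contained in exactly $\lambda$ blocks; a $2$-design is a $2$-$(v,k,\lambda)$ design for some $v,k,\lambda$. -}

module Defs where

open import Level using (0ℓ)
open import Data.Nat using (ℕ; zero; suc)
open import Data.Bool using (Bool; not)
import Data.Bool.Properties as BoolP
open import Data.Fin using (Fin)
import Data.Fin.Properties as FinP
open import Data.Fin.Subset using (Subset; ∣_∣; _∈_)
open import Data.Fin.Subset.Properties using (_∈?_)
open import Data.Vec using (tabulate)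
import Data.Vec.Properties as VecP
open import Data.List using (List; []; _∷_; map; foldr; upTo; allFin; filter; deduplicate; length; cartesianProduct; concatMap)
open import Data.List.Relation.Unary.All using (All)
open import Data.List.Relation.Unary.Unique.Propositional using (Unique)
open import Data.Product using (Σ; ∃; _×_; _,_; proj₁; proj₂)
open import Relation.Nullary using (¬_; Dec; yes; no; does)
open import Relation.Nullary.Decidable using (map′; _×-dec_)
open import Relation.Binary.PropositionalEquality using (_≡_; _≢_; refl; cong)
open import Relation.Binary.Definitions using (DecidableEquality)
open import Algebra.Structures using (IsCommutativeRing)
open import Function.Bundles using (_↔_; Inverse)

record FiniteField (q : ℕ) : Set₁ where
  infixl 7 _*_
  infixl 6 _+_
  field
    Carrier : Set
    _+_ _*_ : Carrier → Carrier → Carrier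
    -_      : Carrier → Carrier
    0# 1#   : Carrier
    isCommutativeRing : IsCommutativeRing _≡_ _+_ _*_ -_ 0# 1#
    0≢1     : 0# ≢ 1#
    inverse : ∀ x → x ≢ 0# → Σ Carrier λ y → x * y ≡ 1#
    enum    : Fin q ↔ Carrier

  elt : Fin q → Carrier
  elt = Inverse.to enum

  idx : Carrier → Fin q
  idx = Inverse.from enum

  _≟_ : DecidableEquality Carrier
  x ≟ y = map′ (λ e → trans' e) (cong idx) (idx x FinP.≟ idx y)
    where
    trans' : idx x ≡ idx y → x ≡ y
    trans' e with Inverse.strictlyInverseˡ enum x | Inverse.strictlyInverseˡ enum y
    ... | ex | ey rewrite e = Relation.Binary.PropositionalEquality.trans (Relation.Binary.PropositionalEquality.sym ex) ey

  elements : List Carrier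
  elements = map elt (allFin q)

  _^_ : Carrier → ℕ → Carrier
  x ^ zero  = 1#
  x ^ suc n = x * (x ^ n)

  ι : ℕ → Carrier
  ι zero    = 0#
  ι (suc k) = 1# + ι k

module _ {q : ℕ} (𝔽 : FiniteField q) where
  open FiniteField 𝔽

  Tr : (p m : ℕ) → Carrier → Carrier
  Tr p m x = foldr (λ j acc → (x ^ (p Data.Nat.^ j)) + acc) 0# (upTo m)

  codeword : (p m l : ℕ) → Carrier → Carrier → Carrier → Carrier → Carrier
  codeword p m l a b h x = Tr p m (a * (x ^ (p Data.Nat.^ l Data.Nat.+ 1)) + b * x) + h

  support : (Carrier → Carrier) → Subset q
  support c = tabulate (λ j → not (does (c (elt j) ≟ 0#)))

  -- range of the parameter a: all of F_q if 2l ≢ m, the subfield F_{p^(m/2)}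
  -- = {a : a^(p^l) = a} if 2l ≡ m
  aRange : (p m l : ℕ) → List Carrier
  aRange p m l with (2 Data.Nat.* l) Data.Nat.≟ m
  ... | yes _ = filter (λ a → (a ^ (p Data.Nat.^ l)) ≟ a) elements
  ... | no  _ = elements

  supportsD : (p m l : ℕ) → List (Subset q)
  supportsD p m l =
    concatMap (λ a → concatMap (λ b → map (λ h → support (codeword p m l a b (ι h)))
                                           (upTo p))
                               elements)
              (aRange p m l)

  blocks : (p m l i : ℕ) → List (Subset q)
  blocks p m l i =
    deduplicate (VecP.≡-dec BoolP._≟_)
      (filter (λ S → ∣ S ∣ Data.Nat.≟ i) (supportsD p m l))

Is2Design : (v : ℕ) → List (Subset v) → Set
Is2Design v ℬ =
  Unique ℬ ×
  (∃ λ k → All (λ B → ∣ B ∣ ≡ k) ℬ) ×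
  (∃ λ λ' → ∀ (x y : Fin v) → x ≢ y →
     length (filter (λ B → (x ∈? B) ×-dec (y ∈? B)) ℬ) ≡ λ')

module Submission where

-- The code is invariant under the affine maps τ(w) = v w + d (v ≠ 0) of 𝔽_q: substituting τ(w) into
-- Tr(a x^(e+1) + b x) + h with e = p^l and expanding (v w + d)^e = v^e w^e + d^e by the Frobenius gives
-- Tr(a v^(e+1) w^(e+1) + β w + γ w^e + κ) + h. Since Tr is invariant under Frobenius,
-- Tr(γ w^e) = Tr(γ^(p^(m-l)) w), and Tr(κ) + h lies in 𝔽_p; so c_{a,b,h} ∘ τ is again a codeword (when
-- 2l = m, a v^(e+1) stays in 𝔽_{p^l} with a). Hence taking preimages under τ permutes the supports of each
-- weight, and as the affine group of 𝔽_q is 2-transitive, every pair of points lies in equally many blocks.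

open import Defs
open import Data.Nat as ℕ using (ℕ; zero; suc; _∸_; _<_; _≤_; z≤n; s≤s; NonZero; _!)
open import Data.Nat.Properties using (_!*_!≢0)
open import Data.Nat.Divisibility using (_∣_; divides; ∣⇒≤; ∣1⇒≡1; m∣m*n)
open import Data.Nat.DivMod using (_%_; _/_; m/n*n≡m; m≡m%n+[m/n]*n; m%n<n)
open import Data.Nat.GCD using (gcd; module Bézout)
open import Data.Nat.Coprimality using (coprime-Bézout; prime⇒coprime)
open import Data.Nat.Primality using (Prime; euclidsLemma; prime⇒nonTrivial; prime⇒nonZero)
open import Data.Nat.Combinatorics using (_C_; k![n∸k]!∣n!; nCn≡1)
open import Data.Nat.Combinatorics.Specification using (nCk≡n!/k![n-k]!)
import Data.Nat.Properties as ℕP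
open import Data.Bool using (Bool; true; false; not)
import Data.Bool.Properties as BoolP
open import Data.Fin using (Fin; zero; suc; punchIn; toℕ; inject₁; fromℕ)
open import Data.Fin.Subset using (Subset; ∣_∣) renaming (_∈_ to _∈ˢ_)
open import Data.Fin.Subset.Properties using (_∈?_)
open import Data.Vec using ([]; _∷_; lookup) renaming (tabulate to tabulateᵛ)
import Data.Vec.Properties as VecP
import Data.Fin.Properties as FinP
open import Data.List using (List; []; _∷_; length; map; replicate; filter; foldr; applyUpTo; tabulate)
open import Data.List.Relation.Unary.Any using (Any; here; there)
open import Data.List.Relation.Unary.All using (All; []; _∷_)
import Data.List.Relation.Unary.All as All
import Data.List.Relation.Unary.All.Properties as AllP
open import Data.List.Relation.Unary.AllPairs using (_∷_)
open import Data.List.Relation.Unary.Unique.Propositional using (Unique)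
import Data.List.Relation.Unary.Unique.Propositional.Properties as UniqueP
import Data.List.Relation.Unary.Unique.DecPropositional.Properties as UniqueDP
open import Data.List.Membership.Propositional using (_∈_; find; lose)
import Data.List.Membership.Propositional.Properties as MemP
import Data.List.Properties as ListP
open import Data.Product using (∃; _×_; _,_; proj₁; proj₂)
open import Data.Sum using (inj₁; inj₂)
open import Data.Empty using (⊥-elim)
open import Function using (_∘_; _↔_; Inverse; mk↔ₛ′)
open import Function.Construct.Composition using (_↔-∘_)
open import Function.Construct.Symmetry using (↔-sym)
open import Relation.Nullary using (¬_; Dec; yes; no; does)
open import Relation.Nullary.Decidable using (_×-dec_)
open import Relation.Binary.PropositionalEquality
open import Relation.Binary.Definitions using (tri<; tri≈; tri>)
open import Algebra.Bundles using (CommutativeRing; CommutativeMonoid)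
import Algebra.Properties.CommutativeMonoid.Sum as Sum
import Algebra.Properties.Group as GroupProperties
import Algebra.Properties.Ring as RingProperties
import Algebra.Properties.Semiring.Exp as SemiringExp
import Algebra.Properties.CommutativeSemiring.Exp as CommutativeSemiringExp
import Algebra.Properties.Semiring.Mult as SemiringMult
import Algebra.Properties.Monoid.Mult as MonoidMult
import Algebra.Properties.CommutativeSemiring.Binomial as Binomial

module _ {A : Set} where

  remove : ∀ {x : A} ys → x ∈ ys → List A
  remove (y ∷ ys) (here _)    = ys
  remove (y ∷ ys) (there x∈) = y ∷ remove ys x∈

  length-remove : ∀ {x : A} ys (x∈ : x ∈ ys) → length ys ≡ suc (length (remove ys x∈))
  length-remove (y ∷ ys) (here _)    = refl
  length-remove (y ∷ ys) (there x∈) = cong suc (length-remove ys x∈)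

  ∈-remove : ∀ {x z : A} ys (x∈ : x ∈ ys) → z ∈ ys → z ≢ x → z ∈ remove ys x∈
  ∈-remove (y ∷ ys) (here refl) (here refl) z≢x = ⊥-elim (z≢x refl)
  ∈-remove (y ∷ ys) (here _)    (there z∈)  _   = z∈
  ∈-remove (y ∷ ys) (there x∈) (here z≡y)  _   = here z≡y
  ∈-remove (y ∷ ys) (there x∈) (there z∈)  z≢x = there (∈-remove ys x∈ z∈ z≢x)

  unique-⊆⇒length≤ : ∀ (xs ys : List A) → Unique xs → (∀ {z} → z ∈ xs → z ∈ ys) → length xs ≤ length ys
  unique-⊆⇒length≤ []       ys _          _  = z≤n
  unique-⊆⇒length≤ (x ∷ xs) ys (x∉xs ∷ u) xs⊆ys =
    subst (suc (length xs) ≤_) (sym (length-remove ys x∈ys))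
      (s≤s (unique-⊆⇒length≤ xs (remove ys x∈ys) u
        (λ z∈xs → ∈-remove ys x∈ys (xs⊆ys (there z∈xs)) (λ z≡x → All.lookup x∉xs z∈xs (sym z≡x)))))
    where x∈ys = xs⊆ys (here refl)

module _ {A B : Set} where

  unique-injection⇒length≤ : ∀ (xs : List A) (ys : List B) (f : A → B) → Unique xs →
    (∀ {x y} → f x ≡ f y → x ≡ y) → (∀ {x} → x ∈ xs → f x ∈ ys) → length xs ≤ length ys
  unique-injection⇒length≤ xs ys f u f-inj f-maps =
    subst (_≤ length ys) (ListP.length-map f xs)
      (unique-⊆⇒length≤ (map f xs) ys (UniqueP.map⁺ f-inj u) image⊆ys)
    where
    image⊆ys : ∀ {z} → z ∈ map f xs → z ∈ ys
    image⊆ys z∈ with MemP.∈-map⁻ f z∈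
    ... | x , x∈xs , refl = f-maps x∈xs

n∣n! : ∀ n → .{{NonZero n}} → n ∣ n !
n∣n! (suc n) = m∣m*n (n !)

module _ {p : ℕ} (p-prime : Prime p) where

  prime∤j! : ∀ j → j < p → ¬ (p ∣ j !)
  prime∤j! zero    j<p p∣1 = ℕP.<⇒≢ (ℕ.nonTrivial⇒n>1 p {{prime⇒nonTrivial p-prime}}) (sym (∣1⇒≡1 p∣1))
  prime∤j! (suc j) j<p p∣j! with euclidsLemma (suc j) (j !) p-prime p∣j!
  ... | inj₁ p∣1+j = ℕP.<⇒≱ j<p (∣⇒≤ p∣1+j)
  ... | inj₂ p∣j!  = prime∤j! j (ℕP.<-trans (ℕP.n<1+n j) j<p) p∣j!

  prime∣pCk : ∀ {k} → 0 < k → k < p → p ∣ p C k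
  prime∣pCk {k} 0<k k<p with euclidsLemma (p C k) (k ! ℕ.* (p ∸ k) !) p-prime p∣pCk*k!*[p-k]!
    where
    pCk*k!*[p-k]!≡p! : (p C k) ℕ.* (k ! ℕ.* (p ∸ k) !) ≡ p !
    pCk*k!*[p-k]!≡p! = trans (cong (ℕ._* (k ! ℕ.* (p ∸ k) !)) (nCk≡n!/k![n-k]! (ℕP.<⇒≤ k<p)))
                             (m/n*n≡m {{k !* (p ∸ k) !≢0}} (k![n∸k]!∣n! (ℕP.<⇒≤ k<p)))
    p∣pCk*k!*[p-k]! : p ∣ (p C k) ℕ.* (k ! ℕ.* (p ∸ k) !)
    p∣pCk*k!*[p-k]! = subst (p ∣_) (sym pCk*k!*[p-k]!≡p!) (n∣n! p {{prime⇒nonZero p-prime}})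
  ... | inj₁ p∣pCk = p∣pCk
  ... | inj₂ p∣k!*[p-k]! with euclidsLemma (k !) ((p ∸ k) !) p-prime p∣k!*[p-k]!
  ...   | inj₁ p∣k!     = ⊥-elim (prime∤j! k k<p p∣k!)
  ...   | inj₂ p∣[p-k]! = ⊥-elim (prime∤j! (p ∸ k) (ℕP.∸-monoʳ-< 0<k (ℕP.<⇒≤ k<p)) p∣[p-k]!)

module FieldProperties {q : ℕ} (𝔽 : FiniteField q) where
  open FiniteField 𝔽 public

  ring : CommutativeRing _ _
  ring = record { isCommutativeRing = isCommutativeRing }

  open CommutativeRing ring public
    using ( +-identityˡ; +-identityʳ; *-identityˡ; *-identityʳ; zeroˡ; zeroʳ
          ; +-comm; *-comm; +-assoc; *-assoc; -‿inverseˡ; -‿inverseʳ; distribʳ; distribˡ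
          ; +-commutativeMonoid; *-commutativeMonoid; semiring; commutativeSemiring )
  open GroupProperties (CommutativeRing.+-group ring) public
    using ()
    renaming ( identityʳ-unique to x+y≡x⇒y≡0; x∙y⁻¹≈ε⇒x≈y to x-y≡0⇒x≡y
             ; //-rightDividesˡ to x-a+a≡x; //-rightDividesʳ to x+a-a≡x )
  open RingProperties (CommutativeRing.ring ring) public using (-1*x≈-x; -‿distribʳ-*)
  open ≡-Reasoning

  open import Algebra.Solver.Ring.NaturalCoefficients.Default commutativeSemiring public

  module Pow = SemiringExp semiring
  module Mult = SemiringMult semiring
  module ∑ = Sum +-commutativeMonoid
  module ∏ = Sum *-commutativeMonoid

  1≢0 : 1# ≢ 0#
  1≢0 = 0≢1 ∘ sym

  _⁻¹[_] : (x : Carrier) → x ≢ 0# → Carrier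
  x ⁻¹[ x≢0 ] = proj₁ (inverse x x≢0)

  x*x⁻¹≡1 : ∀ x (x≢0 : x ≢ 0#) → x * x ⁻¹[ x≢0 ] ≡ 1#
  x*x⁻¹≡1 x x≢0 = proj₂ (inverse x x≢0)

  x⁻¹*x≡1 : ∀ x (x≢0 : x ≢ 0#) → x ⁻¹[ x≢0 ] * x ≡ 1#
  x⁻¹*x≡1 x x≢0 = trans (*-comm _ x) (x*x⁻¹≡1 x x≢0)

  *-cancelˡ : ∀ x {y z} → x ≢ 0# → x * y ≡ x * z → y ≡ z
  *-cancelˡ x {y} {z} x≢0 xy≡xz = begin
    y                  ≡⟨ sym (*-identityˡ y) ⟩
    1# * y             ≡⟨ cong (_* y) (sym (x⁻¹*x≡1 x x≢0)) ⟩
    x⁻¹ * x * y        ≡⟨ *-assoc x⁻¹ x y ⟩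
    x⁻¹ * (x * y)      ≡⟨ cong (x⁻¹ *_) xy≡xz ⟩
    x⁻¹ * (x * z)      ≡⟨ sym (*-assoc x⁻¹ x z) ⟩
    x⁻¹ * x * z        ≡⟨ cong (_* z) (x⁻¹*x≡1 x x≢0) ⟩
    1# * z             ≡⟨ *-identityˡ z ⟩
    z                  ∎
    where x⁻¹ = x ⁻¹[ x≢0 ]

  *-nonzero : ∀ {x y} → x ≢ 0# → y ≢ 0# → x * y ≢ 0#
  *-nonzero {x} {y} x≢0 y≢0 xy≡0 = y≢0 (*-cancelˡ x x≢0 (trans xy≡0 (sym (zeroʳ x))))

  ^≗Pow^ : ∀ x n → x ^ n ≡ x Pow.^ n
  ^≗Pow^ x zero    = refl
  ^≗Pow^ x (suc n) = cong (x *_) (^≗Pow^ x n)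

  ^-homo-* : ∀ x m n → x ^ (m ℕ.+ n) ≡ x ^ m * x ^ n
  ^-homo-* x m n = begin
    x ^ (m ℕ.+ n)           ≡⟨ ^≗Pow^ x (m ℕ.+ n) ⟩
    x Pow.^ (m ℕ.+ n)       ≡⟨ Pow.^-homo-* x m n ⟩
    x Pow.^ m * x Pow.^ n   ≡⟨ sym (cong₂ _*_ (^≗Pow^ x m) (^≗Pow^ x n)) ⟩
    x ^ m * x ^ n           ∎

  ^-assocʳ : ∀ x m n → (x ^ m) ^ n ≡ x ^ (m ℕ.* n)
  ^-assocʳ x m n = begin
    (x ^ m) ^ n             ≡⟨ ^≗Pow^ (x ^ m) n ⟩
    (x ^ m) Pow.^ n         ≡⟨ cong (Pow._^ n) (^≗Pow^ x m) ⟩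
    (x Pow.^ m) Pow.^ n     ≡⟨ Pow.^-assocʳ x m n ⟩
    x Pow.^ (m ℕ.* n)       ≡⟨ sym (^≗Pow^ x (m ℕ.* n)) ⟩
    x ^ (m ℕ.* n)           ∎

  ^-distrib-* : ∀ x y n → (x * y) ^ n ≡ x ^ n * y ^ n
  ^-distrib-* x y n = begin
    (x * y) ^ n             ≡⟨ ^≗Pow^ (x * y) n ⟩
    (x * y) Pow.^ n         ≡⟨ CommutativeSemiringExp.^-distrib-* commutativeSemiring x y n ⟩
    x Pow.^ n * y Pow.^ n   ≡⟨ sym (cong₂ _*_ (^≗Pow^ x n) (^≗Pow^ y n)) ⟩
    x ^ n * y ^ n           ∎

  ^-comm : ∀ x m n → (x ^ m) ^ n ≡ (x ^ n) ^ m
  ^-comm x m n = trans (^-assocʳ x m n) (trans (cong (x ^_) (ℕP.*-comm m n)) (sym (^-assocʳ x n m)))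

  x^1≡x : ∀ x → x ^ 1 ≡ x
  x^1≡x = *-identityʳ

  0^n≡0 : ∀ n → .{{NonZero n}} → 0# ^ n ≡ 0#
  0^n≡0 (suc n) = zeroˡ _

  1^n≡1 : ∀ n → 1# ^ n ≡ 1#
  1^n≡1 zero    = refl
  1^n≡1 (suc n) = trans (*-identityˡ _) (1^n≡1 n)

  ^-nonzero : ∀ {x} n → x ≢ 0# → x ^ n ≢ 0#
  ^-nonzero zero    x≢0 = 1≢0
  ^-nonzero (suc n) x≢0 = *-nonzero x≢0 (^-nonzero n x≢0)

  ι≗×1 : ∀ n → ι n ≡ n Mult.× 1#
  ι≗×1 zero    = refl
  ι≗×1 (suc n) = cong (1# +_) (ι≗×1 n)

  ι-homo-+ : ∀ m n → ι (m ℕ.+ n) ≡ ι m + ι n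
  ι-homo-+ m n = begin
    ι (m ℕ.+ n)                   ≡⟨ ι≗×1 (m ℕ.+ n) ⟩
    (m ℕ.+ n) Mult.× 1#           ≡⟨ MonoidMult.×-homo-+ (CommutativeRing.+-monoid ring) 1# m n ⟩
    m Mult.× 1# + n Mult.× 1#     ≡⟨ sym (cong₂ _+_ (ι≗×1 m) (ι≗×1 n)) ⟩
    ι m + ι n                     ∎

  ι-homo-* : ∀ m n → ι (m ℕ.* n) ≡ ι m * ι n
  ι-homo-* m n = begin
    ι (m ℕ.* n)                   ≡⟨ ι≗×1 (m ℕ.* n) ⟩
    (m ℕ.* n) Mult.× 1#           ≡⟨ Mult.×1-homo-* m n ⟩
    m Mult.× 1# * n Mult.× 1#     ≡⟨ sym (cong₂ _*_ (ι≗×1 m) (ι≗×1 n)) ⟩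
    ι m * ι n                     ∎

  ι-homo-^ : ∀ m n → ι (m ℕ.^ n) ≡ ι m ^ n
  ι-homo-^ m zero    = +-identityʳ 1#
  ι-homo-^ m (suc n) = trans (ι-homo-* m (m ℕ.^ n)) (cong (ι m *_) (ι-homo-^ m n))

  ι-*-zero : ∀ c k → ι k ≡ 0# → ι (c ℕ.* k) ≡ 0#
  ι-*-zero c k ιk≡0 = trans (ι-homo-* c k) (trans (cong (ι c *_) ιk≡0) (zeroʳ (ι c)))

  ι-suc-zero : ∀ n → ι n ≡ 0# → ι (suc n) ≡ 1#
  ι-suc-zero n ιn≡0 = trans (cong (1# +_) ιn≡0) (+-identityʳ 1#)

  ∑-shift : ∀ n (g : ℕ → Carrier) → g n ≡ g 0 → ∑.sum {n} (g ∘ suc ∘ toℕ) ≡ ∑.sum {n} (g ∘ toℕ)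
  ∑-shift zero    g _     = refl
  ∑-shift (suc n) g gn≡g0 = begin
    ∑.sum {suc n} (g ∘ suc ∘ toℕ)
      ≡⟨ ∑.sum-init-last (g ∘ suc ∘ toℕ) ⟩
    ∑.sum {n} (g ∘ suc ∘ toℕ ∘ inject₁) + g (suc (toℕ (fromℕ n)))
      ≡⟨ cong₂ _+_ (∑.sum-cong-≗ {n} (λ j → cong (g ∘ suc) (FinP.toℕ-inject₁ j))) (cong (g ∘ suc) (FinP.toℕ-fromℕ n)) ⟩
    ∑.sum {n} (g ∘ suc ∘ toℕ) + g (suc n)
      ≡⟨ cong (∑.sum {n} (g ∘ suc ∘ toℕ) +_) gn≡g0 ⟩
    ∑.sum {n} (g ∘ suc ∘ toℕ) + g 0
      ≡⟨ +-comm _ (g 0) ⟩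
    g 0 + ∑.sum {n} (g ∘ suc ∘ toℕ)
      ∎

  foldr-applyUpTo : ∀ (g : ℕ → Carrier) f n →
    foldr (λ j acc → g j + acc) 0# (applyUpTo f n) ≡ ∑.sum {n} (g ∘ f ∘ toℕ)
  foldr-applyUpTo g f zero    = refl
  foldr-applyUpTo g f (suc n) = cong (g (f 0) +_) (foldr-applyUpTo g (f ∘ suc) n)

  -- [c₀, …, cₙ₋₁] encodes the monic polynomial c₀ + c₁X + … + cₙ₋₁Xⁿ⁻¹ + Xⁿ.
  evalMonic : List Carrier → Carrier → Carrier
  evalMonic []       x = 1#
  evalMonic (c ∷ cs) x = c + x * evalMonic cs x

  evalMonic-Xⁿ : ∀ n x → evalMonic (replicate n 0#) x ≡ x ^ n
  evalMonic-Xⁿ zero    x = refl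
  evalMonic-Xⁿ (suc n) x = trans (+-identityˡ _) (cong (x *_) (evalMonic-Xⁿ n x))

  quotient : List Carrier → Carrier → List Carrier
  quotient []       r = []
  quotient (c ∷ cs) r = evalMonic (c ∷ cs) r ∷ quotient cs r

  length-quotient : ∀ cs r → length (quotient cs r) ≡ length cs
  length-quotient []       r = refl
  length-quotient (c ∷ cs) r = cong suc (length-quotient cs r)

  -- f(x) − f(r) = (x − r) g(x) for f = c ∷ cs and g = quotient cs r, moved so that no subtraction occurs.
  evalMonic-quotient : ∀ c cs r x →
    evalMonic (c ∷ cs) x + r * evalMonic (quotient cs r) x ≡ x * evalMonic (quotient cs r) x + evalMonic (c ∷ cs) r
  evalMonic-quotient c []        r x =
    solve 4 (λ c x r o → (c :+ x :* o) :+ r :* o := x :* o :+ (c :+ r :* o)) refl c x r 1#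
  evalMonic-quotient c (c′ ∷ cs) r x = begin
    (c + x * fx) + r * (fr + x * g)  ≡⟨ solve 6 (λ c x r fx fr g → (c :+ x :* fx) :+ r :* (fr :+ x :* g)
                                                              := (c :+ r :* fr) :+ x :* (fx :+ r :* g)) refl c x r fx fr g ⟩
    (c + r * fr) + x * (fx + r * g)  ≡⟨ cong (λ z → (c + r * fr) + x * z) (evalMonic-quotient c′ cs r x) ⟩
    (c + r * fr) + x * (x * g + fr)  ≡⟨ solve 6 (λ c x r fx fr g → (c :+ r :* fr) :+ x :* (x :* g :+ fr)
                                                              := x :* (fr :+ x :* g) :+ (c :+ r :* fr)) refl c x r fx fr g ⟩
    x * (fr + x * g) + (c + r * fr)  ∎
    where
    fx = evalMonic (c′ ∷ cs) x
    fr = evalMonic (c′ ∷ cs) r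
    g  = evalMonic (quotient cs r) x

  root-of-quotient : ∀ c cs {r x} → evalMonic (c ∷ cs) r ≡ 0# → evalMonic (c ∷ cs) x ≡ 0# → r ≢ x →
    evalMonic (quotient cs r) x ≡ 0#
  root-of-quotient c cs {r} {x} fr≡0 fx≡0 r≢x with evalMonic (quotient cs r) x ≟ 0#
  ... | yes gx≡0 = gx≡0
  ... | no  gx≢0 = ⊥-elim (r≢x (*-cancelˡ gx gx≢0 (begin
    gx * r                          ≡⟨ *-comm gx r ⟩
    r * gx                          ≡⟨ sym (+-identityˡ _) ⟩
    0# + r * gx                     ≡⟨ cong (_+ r * gx) (sym fx≡0) ⟩
    evalMonic (c ∷ cs) x + r * gx   ≡⟨ evalMonic-quotient c cs r x ⟩
    x * gx + evalMonic (c ∷ cs) r   ≡⟨ cong (x * gx +_) fr≡0 ⟩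
    x * gx + 0#                     ≡⟨ +-identityʳ _ ⟩
    x * gx                          ≡⟨ *-comm x gx ⟩
    gx * x                          ∎)))
    where gx = evalMonic (quotient cs r) x

  roots-bound : ∀ cs rs → Unique rs → All (λ r → evalMonic cs r ≡ 0#) rs → length rs ≤ length cs
  roots-bound cs       []       _            _               = z≤n
  roots-bound []       (r ∷ rs) _            (1≡0 ∷ _)       = ⊥-elim (1≢0 1≡0)
  roots-bound (c ∷ cs) (r ∷ rs) (r∉rs ∷ u) (fr≡0 ∷ fx≡0s) =
    s≤s (subst (length rs ≤_) (length-quotient cs r)
      (roots-bound (quotient cs r) rs u
        (All.zipWith (λ (r≢x , fx≡0) → root-of-quotient c cs fr≡0 fx≡0 r≢x) (r∉rs , fx≡0s))))

  elt∘idx : ∀ x → elt (idx x) ≡ x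
  elt∘idx = Inverse.strictlyInverseˡ enum

  idx∘elt : ∀ j → idx (elt j) ≡ j
  idx∘elt = Inverse.strictlyInverseʳ enum

  module _ {c ℓ} (M : CommutativeMonoid c ℓ) where
    private module M = CommutativeMonoid M
    open Sum M using (sum; sum-permute; sum-cong-≗)

    sum-∘-bijection : (f : Carrier → M.Carrier) (τ : Carrier ↔ Carrier) →
      sum (f ∘ elt) M.≈ sum (f ∘ Inverse.to τ ∘ elt)
    sum-∘-bijection f τ = M.trans (sum-permute (f ∘ elt) (↔-sym enum ↔-∘ (τ ↔-∘ enum)))
                            (M.reflexive (sum-cong-≗ (cong f ∘ elt∘idx ∘ Inverse.to τ ∘ elt)))

  translation : Carrier → Carrier ↔ Carrier
  translation a = mk↔ₛ′ (_+ a) (_+ - a) (x-a+a≡x a) (x+a-a≡x a)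

  dilation : (v : Carrier) → v ≢ 0# → Carrier ↔ Carrier
  dilation v v≢0 = mk↔ₛ′ (v *_) (v⁻¹ *_) (cancel v v⁻¹ (x*x⁻¹≡1 v v≢0)) (cancel v⁻¹ v (x⁻¹*x≡1 v v≢0))
    where
    v⁻¹ = v ⁻¹[ v≢0 ]
    cancel : ∀ u w → u * w ≡ 1# → ∀ x → u * (w * x) ≡ x
    cancel u w uw≡1 x = trans (sym (*-assoc u w x)) (trans (cong (_* x) uw≡1) (*-identityˡ x))

  affine : (v d : Carrier) → v ≢ 0# → Carrier ↔ Carrier
  affine v d v≢0 = translation d ↔-∘ dilation v v≢0

  ι-q≡0 : ι q ≡ 0#
  ι-q≡0 = x+y≡x⇒y≡0 S (ι q) (sym (begin
    S                                    ≡⟨ sum-∘-bijection +-commutativeMonoid (λ x → x) (translation 1#) ⟩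
    ∑.sum {q} (λ j → elt j + 1#)         ≡⟨ ∑.∑-distrib-+ elt (λ _ → 1#) ⟩
    S + ∑.sum {q} (λ _ → 1#)             ≡⟨ cong (S +_) (∑.sum-replicate q) ⟩
    S + q Mult.× 1#                      ≡⟨ cong (S +_) (sym (ι≗×1 q)) ⟩
    S + ι q                              ∎))
    where S = ∑.sum {q} elt

  ∏-const : ∀ n a → ∏.sum {n} (λ _ → a) ≡ a ^ n
  ∏-const zero    a = refl
  ∏-const (suc n) a = cong (a *_) (∏-const n a)

  a*∏-all-but-one : ∀ {n} (t : Fin n → Carrier) k a → t k ≡ 1# → (∀ j → j ≢ k → t j ≡ a) → a * ∏.sum t ≡ a ^ n
  a*∏-all-but-one {suc n} t k a tk≡1 tj≡a = cong (a *_) (begin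
    ∏.sum t                       ≡⟨ ∏.sum-remove t ⟩
    t k * ∏.sum (t ∘ punchIn k)   ≡⟨ cong₂ _*_ tk≡1 (∏.sum-cong-≗ (λ j → tj≡a _ (FinP.punchInᵢ≢i k j))) ⟩
    1# * ∏.sum {n} (λ _ → a)      ≡⟨ *-identityˡ _ ⟩
    ∏.sum {n} (λ _ → a)           ≡⟨ ∏-const n a ⟩
    a ^ n                         ∎)

  nonzeroPart : Carrier → Carrier
  nonzeroPart x with x ≟ 0#
  ... | yes _ = 1#
  ... | no  _ = x

  nonzeroPart-nonzero : ∀ x → nonzeroPart x ≢ 0#
  nonzeroPart-nonzero x with x ≟ 0#
  ... | yes _   = 1≢0
  ... | no  x≢0 = x≢0

  scaleFactor : Carrier → Carrier → Carrier
  scaleFactor v x with x ≟ 0#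
  ... | yes _ = 1#
  ... | no  _ = v

  nonzeroPart-* : ∀ {v} → v ≢ 0# → ∀ x → nonzeroPart (v * x) ≡ scaleFactor v x * nonzeroPart x
  nonzeroPart-* {v} v≢0 x with x ≟ 0# | (v * x) ≟ 0#
  ... | yes _   | yes _    = sym (*-identityˡ 1#)
  ... | yes x≡0 | no  vx≢0 = ⊥-elim (vx≢0 (trans (cong (v *_) x≡0) (zeroʳ v)))
  ... | no  x≢0 | yes vx≡0 = ⊥-elim (*-nonzero v≢0 x≢0 vx≡0)
  ... | no  _   | no  _    = refl

  scaleFactor-0 : ∀ v → scaleFactor v 0# ≡ 1#
  scaleFactor-0 v with 0# ≟ 0#
  ... | yes _   = refl
  ... | no  0≢0 = ⊥-elim (0≢0 refl)

  scaleFactor-nonzero : ∀ v {x} → x ≢ 0# → scaleFactor v x ≡ v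
  scaleFactor-nonzero v {x} x≢0 with x ≟ 0#
  ... | yes x≡0 = ⊥-elim (x≢0 x≡0)
  ... | no  _   = refl

  ∏-nonzero : ∀ {n} (t : Fin n → Carrier) → (∀ j → t j ≢ 0#) → ∏.sum t ≢ 0#
  ∏-nonzero {zero}  t t≢0 = 1≢0
  ∏-nonzero {suc n} t t≢0 = *-nonzero (t≢0 zero) (∏-nonzero (t ∘ suc) (t≢0 ∘ suc))

  -- Multiplication by x ≠ 0 permutes the nonzero elements, so x^(q-1) = 1 (Fermat–Euler).
  x^q≡x : ∀ x → x ^ q ≡ x
  x^q≡x x with x ≟ 0#
  ... | yes refl = 0^n≡0 q {{FinP.nonZeroIndex (idx 0#)}}
  ... | no  x≢0  = sym (*-cancelˡ P (∏-nonzero (nonzeroPart ∘ elt) (nonzeroPart-nonzero ∘ elt)) (begin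
    P * x        ≡⟨ *-comm P x ⟩
    x * P        ≡⟨ cong (x *_) P≡F*P ⟩
    x * (F * P)  ≡⟨ sym (*-assoc x F P) ⟩
    x * F * P    ≡⟨ cong (_* P) x*F≡x^q ⟩
    x ^ q * P    ≡⟨ *-comm (x ^ q) P ⟩
    P * x ^ q    ∎))
    where
    P = ∏.sum {q} (nonzeroPart ∘ elt)
    F = ∏.sum {q} (scaleFactor x ∘ elt)
    P≡F*P : P ≡ F * P
    P≡F*P = begin
      P                                        ≡⟨ sum-∘-bijection *-commutativeMonoid nonzeroPart (dilation x x≢0) ⟩
      ∏.sum {q} (nonzeroPart ∘ (x *_) ∘ elt)   ≡⟨ ∏.sum-cong-≗ (nonzeroPart-* x≢0 ∘ elt) ⟩
      ∏.sum {q} (λ j → scaleFactor x (elt j) * nonzeroPart (elt j))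
                                               ≡⟨ ∏.∑-distrib-+ (scaleFactor x ∘ elt) (nonzeroPart ∘ elt) ⟩
      F * P                                    ∎
    x*F≡x^q : x * F ≡ x ^ q
    x*F≡x^q = a*∏-all-but-one (scaleFactor x ∘ elt) (idx 0#) x
                (trans (cong (scaleFactor x) (elt∘idx 0#)) (scaleFactor-0 x))
                (λ j j≢0 → scaleFactor-nonzero x (λ eltj≡0 → j≢0 (trans (sym (idx∘elt j)) (cong idx eltj≡0))))

  ×≗ι* : ∀ n w → n Mult.× w ≡ ι n * w
  ×≗ι* n w = begin
    n Mult.× w           ≡⟨ cong (n Mult.×_) (sym (*-identityˡ w)) ⟩
    n Mult.× (1# * w)    ≡⟨ sym (Mult.×-assoc-* n 1# w) ⟩
    n Mult.× 1# * w      ≡⟨ cong (_* w) (sym (ι≗×1 n)) ⟩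
    ι n * w              ∎

  [x+y]^n≡x^n+y^n : ∀ n .{{_ : NonZero n}} x y → (∀ {k} → 0 < k → k < n → ι (n C k) ≡ 0#) →
    (x + y) ^ n ≡ x ^ n + y ^ n
  [x+y]^n≡x^n+y^n (suc n) x y middle-vanishes = begin
    (x + y) ^ N                                  ≡⟨ ^≗Pow^ (x + y) N ⟩
    (x + y) Pow.^ N                              ≡⟨ Binom.theorem N x y ⟩
    term 0 + ∑.sum (T ∘ suc)                     ≡⟨ cong (term 0 +_) (∑.sum-init-last (T ∘ suc)) ⟩
    term 0 + (∑.sum (T ∘ suc ∘ inject₁) + T (suc (fromℕ n)))
      ≡⟨ cong₂ (λ u v → term 0 + (u + v)) (trans (∑.sum-cong-≗ middle) (∑.sum-replicate-zero n))
                                          (cong term (FinP.toℕ-fromℕ N)) ⟩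
    term 0 + (0# + term N)                       ≡⟨ cong (term 0 +_) (+-identityˡ (term N)) ⟩
    term 0 + term N                              ≡⟨ +-comm (term 0) (term N) ⟩
    term N + term 0                              ≡⟨ cong₂ _+_ term-N term-0 ⟩
    x ^ N + y ^ N                                ∎
    where
    module Binom = Binomial commutativeSemiring
    N = suc n
    T = Binom.binomialTerm x y N
    term : ℕ → Carrier
    term k = (N C k) Mult.× (x Pow.^ k * y Pow.^ (N ∸ k))
    term-0 : term 0 ≡ y ^ N
    term-0 = begin
      1 Mult.× (1# * y Pow.^ N)   ≡⟨ MonoidMult.×-homo-1 (CommutativeRing.+-monoid ring) _ ⟩
      1# * y Pow.^ N              ≡⟨ *-identityˡ _ ⟩
      y Pow.^ N                   ≡⟨ sym (^≗Pow^ y N) ⟩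
      y ^ N                       ∎
    term-N : term N ≡ x ^ N
    term-N = begin
      (N C N) Mult.× (x Pow.^ N * y Pow.^ (N ∸ N))  ≡⟨ cong₂ (λ c k → c Mult.× (x Pow.^ N * y Pow.^ k)) (nCn≡1 N) (ℕP.n∸n≡0 N) ⟩
      1 Mult.× (x Pow.^ N * 1#)                     ≡⟨ MonoidMult.×-homo-1 (CommutativeRing.+-monoid ring) _ ⟩
      x Pow.^ N * 1#                                ≡⟨ *-identityʳ _ ⟩
      x Pow.^ N                                     ≡⟨ sym (^≗Pow^ x N) ⟩
      x ^ N                                         ∎
    middle : ∀ j → T (suc (inject₁ j)) ≡ 0#
    middle j = begin
      term k          ≡⟨ ×≗ι* (N C k) w ⟩
      ι (N C k) * w   ≡⟨ cong (_* w) (middle-vanishes (s≤s z≤n) k<N) ⟩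
      0# * w          ≡⟨ zeroˡ w ⟩
      0#              ∎
      where
      k = suc (toℕ (inject₁ j))
      w = x Pow.^ k * y Pow.^ (N ∸ k)
      k<N : k < N
      k<N = s≤s (subst (_< n) (sym (FinP.toℕ-inject₁ j)) (FinP.toℕ<n j))

module PrimeCharacteristic {p m : ℕ} (𝔽 : FiniteField (p ℕ.^ m)) (p-prime : Prime p) where
  open FieldProperties 𝔽
  open ≡-Reasoning
  open import Data.List.Membership.DecPropositional _≟_ using () renaming (_∈?_ to _∈ᴸ?_)

  instance
    p-nonZero : NonZero p
    p-nonZero = prime⇒nonZero p-prime

  ι-p≡0 : ι p ≡ 0#
  ι-p≡0 with ι p ≟ 0#
  ... | yes ιp≡0 = ιp≡0
  ... | no  ιp≢0 = ⊥-elim (^-nonzero m ιp≢0 (trans (sym (ι-homo-^ p m)) ι-q≡0))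

  ι-nonzero : ∀ {k} → 0 < k → k < p → ι k ≢ 0#
  ι-nonzero {k} 0<k k<p ιk≡0 with coprime-Bézout (prime⇒coprime p-prime {{ℕ.>-nonZero 0<k}} k<p)
  ... | Bézout.+- a b 1+bk≡ap = 1≢0 (begin
    1#                 ≡⟨ sym (ι-suc-zero (b ℕ.* k) (ι-*-zero b k ιk≡0)) ⟩
    ι (suc (b ℕ.* k))  ≡⟨ cong ι 1+bk≡ap ⟩
    ι (a ℕ.* p)        ≡⟨ ι-*-zero a p ι-p≡0 ⟩
    0#                 ∎)
  ... | Bézout.-+ a b 1+ap≡bk = 1≢0 (begin
    1#                 ≡⟨ sym (ι-suc-zero (a ℕ.* p) (ι-*-zero a p ι-p≡0)) ⟩
    ι (suc (a ℕ.* p))  ≡⟨ cong ι 1+ap≡bk ⟩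
    ι (b ℕ.* k)        ≡⟨ ι-*-zero b k ιk≡0 ⟩
    0#                 ∎)

  ι-<-injective : ∀ {i j} → i < j → j < p → ι i ≢ ι j
  ι-<-injective {i} {j} i<j j<p ιi≡ιj = ι-nonzero (ℕP.m<n⇒0<n∸m i<j) (ℕP.≤-<-trans (ℕP.m∸n≤m j i) j<p)
    (x+y≡x⇒y≡0 (ι i) (ι (j ∸ i)) (begin
      ι i + ι (j ∸ i)   ≡⟨ sym (ι-homo-+ i (j ∸ i)) ⟩
      ι (i ℕ.+ (j ∸ i)) ≡⟨ cong ι (ℕP.m+[n∸m]≡n (ℕP.<⇒≤ i<j)) ⟩
      ι j               ≡⟨ sym ιi≡ιj ⟩
      ι i               ∎))

  ι-injective : ∀ {i j} → i < p → j < p → ι i ≡ ι j → i ≡ j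
  ι-injective {i} {j} i<p j<p ιi≡ιj with ℕP.<-cmp i j
  ... | tri< i<j _ _ = ⊥-elim (ι-<-injective i<j j<p ιi≡ιj)
  ... | tri≈ _ i≡j _ = i≡j
  ... | tri> _ _ j<i = ⊥-elim (ι-<-injective j<i i<p (sym ιi≡ιj))

  ι-n≡ι[n%p] : ∀ n → ι n ≡ ι (n % p)
  ι-n≡ι[n%p] n = begin
    ι n                                 ≡⟨ cong ι (m≡m%n+[m/n]*n n p) ⟩
    ι (n % p ℕ.+ n / p ℕ.* p)           ≡⟨ ι-homo-+ (n % p) _ ⟩
    ι (n % p) + ι (n / p ℕ.* p)         ≡⟨ cong (ι (n % p) +_) (ι-*-zero (n / p) p ι-p≡0) ⟩
    ι (n % p) + 0#                      ≡⟨ +-identityʳ _ ⟩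
    ι (n % p)                           ∎

  frobenius : ∀ x y → (x + y) ^ p ≡ x ^ p + y ^ p
  frobenius x y = [x+y]^n≡x^n+y^n p x y (λ 0<k k<p → p∣n⇒ιn≡0 (prime∣pCk p-prime 0<k k<p))
    where
    p∣n⇒ιn≡0 : ∀ {n} → p ∣ n → ι n ≡ 0#
    p∣n⇒ιn≡0 (divides c refl) = ι-*-zero c p ι-p≡0

  ^p^j-homo-+ : ∀ j x y → (x + y) ^ (p ℕ.^ j) ≡ x ^ (p ℕ.^ j) + y ^ (p ℕ.^ j)
  ^p^j-homo-+ zero    x y = trans (x^1≡x (x + y)) (sym (cong₂ _+_ (x^1≡x x) (x^1≡x y)))
  ^p^j-homo-+ (suc j) x y = begin
    (x + y) ^ (p ℕ.* p ℕ.^ j)                 ≡⟨ sym (^-assocʳ (x + y) p (p ℕ.^ j)) ⟩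
    ((x + y) ^ p) ^ (p ℕ.^ j)                 ≡⟨ cong (_^ (p ℕ.^ j)) (frobenius x y) ⟩
    (x ^ p + y ^ p) ^ (p ℕ.^ j)               ≡⟨ ^p^j-homo-+ j (x ^ p) (y ^ p) ⟩
    (x ^ p) ^ (p ℕ.^ j) + (y ^ p) ^ (p ℕ.^ j) ≡⟨ cong₂ _+_ (^-assocʳ x p (p ℕ.^ j)) (^-assocʳ y p (p ℕ.^ j)) ⟩
    x ^ (p ℕ.* p ℕ.^ j) + y ^ (p ℕ.* p ℕ.^ j) ∎

  ∑-^p : ∀ {n} (t : Fin n → Carrier) → ∑.sum t ^ p ≡ ∑.sum (λ j → t j ^ p)
  ∑-^p {zero}  t = 0^n≡0 p
  ∑-^p {suc n} t = trans (frobenius (t zero) (∑.sum (t ∘ suc))) (cong (t zero ^ p +_) (∑-^p (t ∘ suc)))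

  trace : Carrier → Carrier
  trace = Tr 𝔽 p m

  conjugates : Carrier → Fin m → Carrier
  conjugates z j = z ^ (p ℕ.^ toℕ j)

  trace≡∑conjugates : ∀ z → trace z ≡ ∑.sum (conjugates z)
  trace≡∑conjugates z = foldr-applyUpTo (λ j → z ^ (p ℕ.^ j)) (λ j → j) m

  trace-homo-+ : ∀ x y → trace (x + y) ≡ trace x + trace y
  trace-homo-+ x y = begin
    trace (x + y)                                       ≡⟨ trace≡∑conjugates (x + y) ⟩
    ∑.sum (conjugates (x + y))                          ≡⟨ ∑.sum-cong-≗ {m} (λ j → ^p^j-homo-+ (toℕ j) x y) ⟩
    ∑.sum {m} (λ j → conjugates x j + conjugates y j)   ≡⟨ ∑.∑-distrib-+ (conjugates x) (conjugates y) ⟩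
    ∑.sum (conjugates x) + ∑.sum (conjugates y)         ≡⟨ sym (cong₂ _+_ (trace≡∑conjugates x) (trace≡∑conjugates y)) ⟩
    trace x + trace y                                   ∎

  -- Raising to the p-th power shifts the conjugates z^(p^j) cyclically, as z^(p^m) = z.
  ∑conjugates-^p : ∀ z → ∑.sum {m} (λ j → conjugates z j ^ p) ≡ ∑.sum (conjugates z)
  ∑conjugates-^p z = begin
    ∑.sum {m} (λ j → conjugates z j ^ p)        ≡⟨ ∑.sum-cong-≗ {m} (λ j → ^-assocʳ z (p ℕ.^ toℕ j) p) ⟩
    ∑.sum {m} (λ j → z ^ (p ℕ.^ toℕ j ℕ.* p))   ≡⟨ ∑.sum-cong-≗ {m} (λ j → cong (z ^_) (ℕP.*-comm (p ℕ.^ toℕ j) p)) ⟩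
    ∑.sum {m} (λ j → z ^ (p ℕ.^ suc (toℕ j)))   ≡⟨ ∑-shift m (λ j → z ^ (p ℕ.^ j)) (trans (x^q≡x z) (sym (x^1≡x z))) ⟩
    ∑.sum (conjugates z)                        ∎

  trace-^p : ∀ z → trace (z ^ p) ≡ trace z
  trace-^p z = begin
    trace (z ^ p)                          ≡⟨ trace≡∑conjugates (z ^ p) ⟩
    ∑.sum (conjugates (z ^ p))             ≡⟨ ∑.sum-cong-≗ {m} (λ j → ^-comm z p (p ℕ.^ toℕ j)) ⟩
    ∑.sum {m} (λ j → conjugates z j ^ p)   ≡⟨ ∑conjugates-^p z ⟩
    ∑.sum (conjugates z)                   ≡⟨ sym (trace≡∑conjugates z) ⟩
    trace z                                ∎

  trace-^p^j : ∀ j z → trace (z ^ (p ℕ.^ j)) ≡ trace z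
  trace-^p^j zero    z = cong trace (x^1≡x z)
  trace-^p^j (suc j) z = begin
    trace (z ^ (p ℕ.* p ℕ.^ j))   ≡⟨ cong trace (sym (^-assocʳ z p (p ℕ.^ j))) ⟩
    trace ((z ^ p) ^ (p ℕ.^ j))   ≡⟨ trace-^p^j j (z ^ p) ⟩
    trace (z ^ p)                 ≡⟨ trace-^p z ⟩
    trace z                       ∎

  trace^p≡trace : ∀ z → trace z ^ p ≡ trace z
  trace^p≡trace z = begin
    trace z ^ p                            ≡⟨ cong (_^ p) (trace≡∑conjugates z) ⟩
    ∑.sum (conjugates z) ^ p               ≡⟨ ∑-^p (conjugates z) ⟩
    ∑.sum {m} (λ j → conjugates z j ^ p)   ≡⟨ ∑conjugates-^p z ⟩
    ∑.sum (conjugates z)                   ≡⟨ sym (trace≡∑conjugates z) ⟩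
    trace z                                ∎

  ι-^p : ∀ k → ι k ^ p ≡ ι k
  ι-^p zero    = 0^n≡0 p
  ι-^p (suc k) = trans (frobenius 1# (ι k)) (cong₂ _+_ (1^n≡1 p) (ι-^p k))

  2+[p∸2]≡p : 2 ℕ.+ (p ∸ 2) ≡ p
  2+[p∸2]≡p = ℕP.m+[n∸m]≡n (ℕ.nonTrivial⇒n>1 p {{prime⇒nonTrivial p-prime}})

  X^p-X : List Carrier
  X^p-X = 0# ∷ - 1# ∷ replicate (p ∸ 2) 0#

  length-X^p-X : length X^p-X ≡ p
  length-X^p-X = trans (cong (λ n → suc (suc n)) (ListP.length-replicate (p ∸ 2))) 2+[p∸2]≡p

  evalMonic-X^p-X : ∀ t → t ^ p ≡ t → evalMonic X^p-X t ≡ 0#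
  evalMonic-X^p-X t t^p≡t = begin
    0# + t * (- 1# + t * evalMonic (replicate (p ∸ 2) 0#) t)  ≡⟨ +-identityˡ _ ⟩
    t * (- 1# + t * evalMonic (replicate (p ∸ 2) 0#) t)       ≡⟨ cong (λ u → t * (- 1# + t * u)) (evalMonic-Xⁿ (p ∸ 2) t) ⟩
    t * (- 1# + t * t ^ (p ∸ 2))                              ≡⟨ distribˡ t (- 1#) (t * t ^ (p ∸ 2)) ⟩
    t * - 1# + t ^ (2 ℕ.+ (p ∸ 2))                            ≡⟨ cong₂ _+_ (trans (*-comm t (- 1#)) (-1*x≈-x t)) (cong (t ^_) 2+[p∸2]≡p) ⟩
    - t + t ^ p                                               ≡⟨ cong (- t +_) t^p≡t ⟩
    - t + t                                                   ≡⟨ -‿inverseˡ t ⟩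
    0#                                                        ∎

  primeField : List Carrier
  primeField = tabulate {n = p} (ι ∘ toℕ)

  -- X^p − X has degree p, and its p distinct roots ι 0, …, ι (p−1) leave no room for another one.
  ^p-fixed⇒∈primeField : ∀ t → t ^ p ≡ t → ∃ λ h → h < p × t ≡ ι h
  ^p-fixed⇒∈primeField t t^p≡t with t ∈ᴸ? primeField
  ... | yes t∈ with MemP.∈-tabulate⁻ t∈
  ...   | j , t≡ιj = toℕ j , FinP.toℕ<n j , t≡ιj
  ^p-fixed⇒∈primeField t t^p≡t | no t∉ = ⊥-elim (ℕP.<⇒≱ p<p+1 (roots-bound X^p-X (t ∷ primeField)
      (AllP.¬Any⇒All¬ primeField t∉ ∷ UniqueP.tabulate⁺ ιj-injective)
      (evalMonic-X^p-X t t^p≡t ∷ AllP.tabulate⁺ (λ j → evalMonic-X^p-X (ι (toℕ j)) (ι-^p (toℕ j))))))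
    where
    ιj-injective : ∀ {i j : Fin p} → ι (toℕ i) ≡ ι (toℕ j) → i ≡ j
    ιj-injective {i} {j} eq = FinP.toℕ-injective (ι-injective (FinP.toℕ<n i) (FinP.toℕ<n j) eq)
    p<p+1 : length X^p-X < length (t ∷ primeField)
    p<p+1 = subst₂ _<_ (sym length-X^p-X) (cong suc (sym (ListP.length-tabulate _))) (ℕP.n<1+n p)

  trace∈primeField : ∀ z → ∃ λ h → h < p × trace z ≡ ι h
  trace∈primeField z = ^p-fixed⇒∈primeField (trace z) (trace^p≡trace z)

module AffineInvariance {p m l : ℕ} (𝔽 : FiniteField (p ℕ.^ m)) (p-prime : Prime p) (l≤m : l ≤ m) where
  open FieldProperties 𝔽
  open PrimeCharacteristic {m = m} 𝔽 p-prime
  open ≡-Reasoning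

  e : ℕ
  e = p ℕ.^ l

  x^[e+1]≡x^e*x : ∀ x → x ^ (e ℕ.+ 1) ≡ x ^ e * x
  x^[e+1]≡x^e*x x = trans (^-homo-* x e 1) (cong (x ^ e *_) (x^1≡x x))

  e-thRoot : Carrier → Carrier
  e-thRoot γ = γ ^ (p ℕ.^ (m ∸ l))

  e-thRoot-^e : ∀ γ → e-thRoot γ ^ e ≡ γ
  e-thRoot-^e γ = begin
    (γ ^ (p ℕ.^ (m ∸ l))) ^ e        ≡⟨ ^-assocʳ γ (p ℕ.^ (m ∸ l)) e ⟩
    γ ^ (p ℕ.^ (m ∸ l) ℕ.* e)        ≡⟨ cong (γ ^_) (sym (ℕP.^-distribˡ-+-* p (m ∸ l) l)) ⟩
    γ ^ (p ℕ.^ (m ∸ l ℕ.+ l))        ≡⟨ cong (λ k → γ ^ (p ℕ.^ k)) (ℕP.m∸n+n≡m l≤m) ⟩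
    γ ^ (p ℕ.^ m)                    ≡⟨ x^q≡x γ ⟩
    γ                                ∎

  trace-γx^e : ∀ γ x → trace (γ * x ^ e) ≡ trace (e-thRoot γ * x)
  trace-γx^e γ x = begin
    trace (γ * x ^ e)                  ≡⟨ cong (λ u → trace (u * x ^ e)) (sym (e-thRoot-^e γ)) ⟩
    trace (e-thRoot γ ^ e * x ^ e)     ≡⟨ cong trace (sym (^-distrib-* (e-thRoot γ) x e)) ⟩
    trace ((e-thRoot γ * x) ^ e)       ≡⟨ trace-^p^j l (e-thRoot γ * x) ⟩
    trace (e-thRoot γ * x)             ∎

  affine-expansion : ∀ a b v d w →
    a * (v * w + d) ^ (e ℕ.+ 1) + b * (v * w + d)
      ≡ ((a * v ^ (e ℕ.+ 1)) * w ^ (e ℕ.+ 1) + (a * d ^ e * v + b * v) * w + (a * v ^ e * d) * w ^ e)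
        + (a * d ^ e * d + b * d)
  affine-expansion a b v d w = begin
    a * (v * w + d) ^ (e ℕ.+ 1) + b * (v * w + d)
      ≡⟨ cong (λ u → a * u + b * (v * w + d)) (x^[e+1]≡x^e*x (v * w + d)) ⟩
    a * ((v * w + d) ^ e * (v * w + d)) + b * (v * w + d)
      ≡⟨ cong (λ u → a * (u * (v * w + d)) + b * (v * w + d))
              (trans (^p^j-homo-+ l (v * w) d) (cong (_+ d ^ e) (^-distrib-* v w e))) ⟩
    a * ((v ^ e * w ^ e + d ^ e) * (v * w + d)) + b * (v * w + d)
      ≡⟨ solve 8 (λ a b v d w V W D → a :* ((V :* W :+ D) :* (v :* w :+ d)) :+ b :* (v :* w :+ d)
                   := ((a :* (V :* v)) :* (W :* w) :+ (a :* D :* v :+ b :* v) :* w :+ (a :* V :* d) :* W)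
                      :+ (a :* D :* d :+ b :* d))
               refl a b v d w (v ^ e) (w ^ e) (d ^ e) ⟩
    ((a * (v ^ e * v)) * (w ^ e * w) + (a * d ^ e * v + b * v) * w + (a * v ^ e * d) * w ^ e)
      + (a * d ^ e * d + b * d)
      ≡⟨ cong₂ (λ u u′ → ((a * u) * u′ + (a * d ^ e * v + b * v) * w + (a * v ^ e * d) * w ^ e)
                          + (a * d ^ e * d + b * d))
               (sym (x^[e+1]≡x^e*x v)) (sym (x^[e+1]≡x^e*x w)) ⟩
    ((a * v ^ (e ℕ.+ 1)) * w ^ (e ℕ.+ 1) + (a * d ^ e * v + b * v) * w + (a * v ^ e * d) * w ^ e)
      + (a * d ^ e * d + b * d)
      ∎

  c : Carrier → Carrier → Carrier → Carrier → Carrier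
  c = codeword 𝔽 p m l

  codeword-∘-affine : ∀ v d a b h → ∃ λ b′ → ∃ λ h′ → h′ < p ×
    (∀ w → c a b (ι h) (v * w + d) ≡ c (a * v ^ (e ℕ.+ 1)) b′ (ι h′) w)
  codeword-∘-affine v d a b h = β + e-thRoot γ , (t ℕ.+ h) % p , m%n<n (t ℕ.+ h) p , λ w → begin
    trace (a * (v * w + d) ^ (e ℕ.+ 1) + b * (v * w + d)) + ι h
      ≡⟨ cong (λ u → trace u + ι h) (affine-expansion a b v d w) ⟩
    trace ((A w + β * w + γ * w ^ e) + κ) + ι h
      ≡⟨ cong (_+ ι h) (trans (trace-homo-+ _ κ) (cong (_+ trace κ) (trace-homo-+ (A w + β * w) (γ * w ^ e)))) ⟩
    trace (A w + β * w) + trace (γ * w ^ e) + trace κ + ι h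
      ≡⟨ cong (λ u → trace (A w + β * w) + u + trace κ + ι h) (trace-γx^e γ w) ⟩
    trace (A w + β * w) + trace (e-thRoot γ * w) + trace κ + ι h
      ≡⟨ cong (λ u → u + trace κ + ι h) (sym (trace-homo-+ (A w + β * w) (e-thRoot γ * w))) ⟩
    trace (A w + β * w + e-thRoot γ * w) + trace κ + ι h
      ≡⟨ +-assoc _ (trace κ) (ι h) ⟩
    trace (A w + β * w + e-thRoot γ * w) + (trace κ + ι h)
      ≡⟨ cong₂ _+_ (cong trace (linear-part w)) constant-part ⟩
    trace (A w + (β + e-thRoot γ) * w) + ι ((t ℕ.+ h) % p)
      ∎
    where
    A : Carrier → Carrier
    A w = (a * v ^ (e ℕ.+ 1)) * w ^ (e ℕ.+ 1)
    β = a * d ^ e * v + b * v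
    γ = a * v ^ e * d
    κ = a * d ^ e * d + b * d
    t = proj₁ (trace∈primeField κ)

    linear-part : ∀ w → A w + β * w + e-thRoot γ * w ≡ A w + (β + e-thRoot γ) * w
    linear-part w = trans (+-assoc (A w) _ _) (cong (A w +_) (sym (distribʳ w β (e-thRoot γ))))

    constant-part : trace κ + ι h ≡ ι ((t ℕ.+ h) % p)
    constant-part = begin
      trace κ + ι h        ≡⟨ cong (_+ ι h) (proj₂ (proj₂ (trace∈primeField κ))) ⟩
      ι t + ι h            ≡⟨ sym (ι-homo-+ t h) ⟩
      ι (t ℕ.+ h)          ≡⟨ ι-n≡ι[n%p] (t ℕ.+ h) ⟩
      ι ((t ℕ.+ h) % p)    ∎

  subfield-closed : 2 ℕ.* l ≡ m → ∀ {a} v → a ^ e ≡ a → (a * v ^ (e ℕ.+ 1)) ^ e ≡ a * v ^ (e ℕ.+ 1)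
  subfield-closed 2l≡m {a} v a^e≡a = begin
    (a * v ^ (e ℕ.+ 1)) ^ e          ≡⟨ ^-distrib-* a (v ^ (e ℕ.+ 1)) e ⟩
    a ^ e * (v ^ (e ℕ.+ 1)) ^ e      ≡⟨ cong₂ _*_ a^e≡a (^-assocʳ v (e ℕ.+ 1) e) ⟩
    a * v ^ ((e ℕ.+ 1) ℕ.* e)        ≡⟨ cong (λ k → a * v ^ k) [e+1]e≡q+e ⟩
    a * v ^ (p ℕ.^ m ℕ.+ e)          ≡⟨ cong (a *_) (^-homo-* v (p ℕ.^ m) e) ⟩
    a * (v ^ (p ℕ.^ m) * v ^ e)      ≡⟨ cong (λ u → a * (u * v ^ e)) (x^q≡x v) ⟩
    a * (v * v ^ e)                  ≡⟨ cong (a *_) (trans (*-comm v (v ^ e)) (sym (x^[e+1]≡x^e*x v))) ⟩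
    a * v ^ (e ℕ.+ 1)                ∎
    where
    [e+1]e≡q+e : (e ℕ.+ 1) ℕ.* e ≡ p ℕ.^ m ℕ.+ e
    [e+1]e≡q+e = begin
      (e ℕ.+ 1) ℕ.* e           ≡⟨ ℕP.*-distribʳ-+ e e 1 ⟩
      e ℕ.* e ℕ.+ 1 ℕ.* e       ≡⟨ cong₂ ℕ._+_ (sym (ℕP.^-distribˡ-+-* p l l)) (ℕP.*-identityˡ e) ⟩
      p ℕ.^ (l ℕ.+ l) ℕ.+ e     ≡⟨ cong (λ k → p ℕ.^ k ℕ.+ e) (trans (cong (l ℕ.+_) (sym (ℕP.+-identityʳ l))) 2l≡m) ⟩
      p ℕ.^ m ℕ.+ e             ∎

module SupportDesign {p m l : ℕ} (𝔽 : FiniteField (p ℕ.^ m)) (p-prime : Prime p) (l≤m : l ≤ m) where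
  open FieldProperties 𝔽
  open AffineInvariance 𝔽 p-prime l≤m
  open ≡-Reasoning

  q : ℕ
  q = p ℕ.^ m

  preimage : (Carrier → Carrier) → Subset q → Subset q
  preimage τ S = tabulateᵛ (λ j → lookup S (idx (τ (elt j))))

  preimage-support : ∀ τ f → preimage τ (support 𝔽 f) ≡ support 𝔽 (f ∘ τ)
  preimage-support τ f = VecP.tabulate-cong (λ j →
    trans (VecP.lookup∘tabulate _ (idx (τ (elt j)))) (cong (λ x → not (does (f x ≟ 0#))) (elt∘idx _)))

  support-cong : ∀ {f g} → (∀ x → f x ≡ g x) → support 𝔽 f ≡ support 𝔽 g
  support-cong f≗g = VecP.tabulate-cong (λ j → cong (λ x → not (does (x ≟ 0#))) (f≗g (elt j)))

  indicator : Bool → ℕ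
  indicator true  = 1
  indicator false = 0

  module ∑ℕ = Sum ℕP.+-0-commutativeMonoid

  ∣S∣≡∑indicator : ∀ {n} (S : Subset n) → ∣ S ∣ ≡ ∑ℕ.sum (indicator ∘ lookup S)
  ∣S∣≡∑indicator []          = refl
  ∣S∣≡∑indicator (true ∷ S)  = cong suc (∣S∣≡∑indicator S)
  ∣S∣≡∑indicator (false ∷ S) = ∣S∣≡∑indicator S

  module _ (τ : Carrier ↔ Carrier) where
    private
      τ→ = Inverse.to τ
      τ← = Inverse.from τ

    lookup-preimage : ∀ S k → lookup (preimage τ→ S) (idx (τ← (elt k))) ≡ lookup S k
    lookup-preimage S k = begin
      lookup (preimage τ→ S) (idx (τ← (elt k)))      ≡⟨ VecP.lookup∘tabulate _ (idx (τ← (elt k))) ⟩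
      lookup S (idx (τ→ (elt (idx (τ← (elt k))))))  ≡⟨ cong (λ x → lookup S (idx (τ→ x))) (elt∘idx _) ⟩
      lookup S (idx (τ→ (τ← (elt k))))              ≡⟨ cong (lookup S ∘ idx) (Inverse.strictlyInverseˡ τ (elt k)) ⟩
      lookup S (idx (elt k))                        ≡⟨ cong (lookup S) (idx∘elt k) ⟩
      lookup S k                                    ∎

    preimage-injective : ∀ {S S′} → preimage τ→ S ≡ preimage τ→ S′ → S ≡ S′
    preimage-injective {S} {S′} eq = begin
      S                    ≡⟨ sym (VecP.tabulate∘lookup S) ⟩
      tabulateᵛ (lookup S)  ≡⟨ VecP.tabulate-cong (λ k → trans (sym (lookup-preimage S k))
                                (trans (cong (λ X → lookup X (idx (τ← (elt k)))) eq) (lookup-preimage S′ k))) ⟩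
      tabulateᵛ (lookup S′) ≡⟨ VecP.tabulate∘lookup S′ ⟩
      S′                   ∎

    ∣preimage∣ : ∀ S → ∣ preimage τ→ S ∣ ≡ ∣ S ∣
    ∣preimage∣ S = begin
      ∣ preimage τ→ S ∣                                    ≡⟨ ∣S∣≡∑indicator (preimage τ→ S) ⟩
      ∑ℕ.sum (indicator ∘ lookup (preimage τ→ S))         ≡⟨ ∑ℕ.sum-cong-≗ {q} (cong indicator ∘ VecP.lookup∘tabulate _) ⟩
      ∑ℕ.sum {q} (indicator ∘ lookup S ∘ idx ∘ τ→ ∘ elt)  ≡⟨ sym (sum-∘-bijection ℕP.+-0-commutativeMonoid (indicator ∘ lookup S ∘ idx) τ) ⟩
      ∑ℕ.sum {q} (indicator ∘ lookup S ∘ idx ∘ elt)       ≡⟨ ∑ℕ.sum-cong-≗ {q} (cong (indicator ∘ lookup S) ∘ idx∘elt) ⟩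
      ∑ℕ.sum (indicator ∘ lookup S)                       ≡⟨ sym (∣S∣≡∑indicator S) ⟩
      ∣ S ∣                                               ∎

    ∈-preimage : ∀ {S j} → idx (τ→ (elt j)) ∈ˢ S → j ∈ˢ preimage τ→ S
    ∈-preimage {S} {j} τj∈S = VecP.lookup⇒[]= j (preimage τ→ S)
      (trans (VecP.lookup∘tabulate _ j) (VecP.[]=⇒lookup τj∈S))

  ∈-elements : ∀ x → x ∈ elements
  ∈-elements x = subst (_∈ elements) (elt∘idx x) (MemP.∈-map⁺ elt (MemP.∈-allFin (idx x)))

  ∈-aRange : ∀ {a} v → a ∈ aRange 𝔽 p m l → a * v ^ (e ℕ.+ 1) ∈ aRange 𝔽 p m l
  ∈-aRange {a} v a∈ with 2 ℕ.* l ℕ.≟ m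
  ... | yes 2l≡m = MemP.∈-filter⁺ (λ a → (a ^ e) ≟ a) (∈-elements _)
                     (subfield-closed 2l≡m v (proj₂ (MemP.∈-filter⁻ (λ a → (a ^ e) ≟ a) {xs = elements} a∈)))
  ... | no  _    = ∈-elements _

  𝒮 : List (Subset q)
  𝒮 = supportsD 𝔽 p m l

  ∈-𝒮⁻ : ∀ {S} → S ∈ 𝒮 → ∃ λ a → ∃ λ b → ∃ λ h → a ∈ aRange 𝔽 p m l × h < p × S ≡ support 𝔽 (c a b (ι h))
  ∈-𝒮⁻ S∈ with find (MemP.∈-concatMap⁻ _ {xs = aRange 𝔽 p m l} S∈)
  ... | a , a∈ , S∈ₐ with find (MemP.∈-concatMap⁻ _ {xs = elements} S∈ₐ)
  ... | b , _ , S∈ₐᵦ with MemP.∈-map⁻ _ S∈ₐᵦ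
  ... | h , h∈ , S≡ = a , b , h , a∈ , MemP.∈-upTo⁻ h∈ , S≡

  ∈-𝒮⁺ : ∀ {a} b {h} → a ∈ aRange 𝔽 p m l → h < p → support 𝔽 (c a b (ι h)) ∈ 𝒮
  ∈-𝒮⁺ b a∈ h<p = MemP.∈-concatMap⁺ _ {xs = aRange 𝔽 p m l} (lose a∈
    (MemP.∈-concatMap⁺ _ {xs = elements} (lose (∈-elements b) (MemP.∈-map⁺ _ (MemP.∈-upTo⁺ h<p)))))

  preimage-affine-support : ∀ v d (v≢0 : v ≢ 0#) {a} b {h} → a ∈ aRange 𝔽 p m l →
    preimage (Inverse.to (affine v d v≢0)) (support 𝔽 (c a b (ι h))) ∈ 𝒮
  preimage-affine-support v d v≢0 {a} b {h} a∈ =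
    subst (_∈ 𝒮) (sym τ⁻¹S≡) (∈-𝒮⁺ b′ (∈-aRange v a∈) h′<p)
    where
    τ : Carrier → Carrier
    τ w = v * w + d
    b′ = proj₁ (codeword-∘-affine v d a b h)
    h′ = proj₁ (proj₂ (codeword-∘-affine v d a b h))
    h′<p = proj₁ (proj₂ (proj₂ (codeword-∘-affine v d a b h)))
    c∘τ≗c′ = proj₂ (proj₂ (proj₂ (codeword-∘-affine v d a b h)))
    τ⁻¹S≡ : preimage τ (support 𝔽 (c a b (ι h))) ≡ support 𝔽 (c (a * v ^ (e ℕ.+ 1)) b′ (ι h′))
    τ⁻¹S≡ = trans (preimage-support τ (c a b (ι h))) (support-cong c∘τ≗c′)

  preimage-affine-𝒮 : ∀ v d (v≢0 : v ≢ 0#) {S} → S ∈ 𝒮 → preimage (Inverse.to (affine v d v≢0)) S ∈ 𝒮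
  preimage-affine-𝒮 v d v≢0 S∈ with ∈-𝒮⁻ S∈
  ... | a , b , h , a∈ , _ , refl = preimage-affine-support v d v≢0 b {h} a∈

  module Blocks (i : ℕ) where
    ℬ : List (Subset q)
    ℬ = blocks 𝔽 p m l i

    private
      weight-i? : (S : Subset q) → Dec (∣ S ∣ ≡ i)
      weight-i? S = ∣ S ∣ ℕ.≟ i

      _≟ˢ_ : (S S′ : Subset q) → Dec (S ≡ S′)
      _≟ˢ_ = VecP.≡-dec BoolP._≟_

    ∈-ℬ⁻ : ∀ {B} → B ∈ ℬ → B ∈ 𝒮 × ∣ B ∣ ≡ i
    ∈-ℬ⁻ B∈ = MemP.∈-filter⁻ weight-i? {xs = 𝒮} (MemP.∈-deduplicate⁻ _≟ˢ_ (filter weight-i? 𝒮) B∈)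

    ∈-ℬ⁺ : ∀ {B} → B ∈ 𝒮 → ∣ B ∣ ≡ i → B ∈ ℬ
    ∈-ℬ⁺ B∈ ∣B∣≡i = MemP.∈-deduplicate⁺ _≟ˢ_ (MemP.∈-filter⁺ weight-i? B∈ ∣B∣≡i)

    ℬ-unique : Unique ℬ
    ℬ-unique = UniqueDP.deduplicate-! _≟ˢ_ (filter weight-i? 𝒮)

    contains? : (x y : Fin q) (B : Subset q) → Dec (x ∈ˢ B × y ∈ˢ B)
    contains? x y B = (x ∈? B) ×-dec (y ∈? B)

    blocksThrough : Fin q → Fin q → List (Subset q)
    blocksThrough x y = filter (contains? x y) ℬ

    blocksThrough-≤ : ∀ v d (v≢0 : v ≢ 0#) {x y x′ y′} →
      let τ = Inverse.to (affine v d v≢0) in idx (τ (elt x′)) ≡ x → idx (τ (elt y′)) ≡ y →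
      length (blocksThrough x y) ≤ length (blocksThrough x′ y′)
    blocksThrough-≤ v d v≢0 {x} {y} {x′} {y′} τx′≡x τy′≡y =
      unique-injection⇒length≤ (blocksThrough x y) (blocksThrough x′ y′) (preimage (Inverse.to τ))
        (UniqueP.filter⁺ (contains? x y) ℬ-unique) (preimage-injective τ) maps-into
      where
      τ = affine v d v≢0
      maps-into : ∀ {B} → B ∈ blocksThrough x y → preimage (Inverse.to τ) B ∈ blocksThrough x′ y′
      maps-into {B} B∈ with MemP.∈-filter⁻ (contains? x y) {xs = ℬ} B∈
      ... | B∈ℬ , x∈B , y∈B with ∈-ℬ⁻ B∈ℬ
      ... | B∈𝒮 , ∣B∣≡i = MemP.∈-filter⁺ (contains? x′ y′)
        (∈-ℬ⁺ (preimage-affine-𝒮 v d v≢0 B∈𝒮) (trans (∣preimage∣ τ B) ∣B∣≡i))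
        (∈-preimage τ (subst (_∈ˢ B) (sym τx′≡x) x∈B) , ∈-preimage τ (subst (_∈ˢ B) (sym τy′≡y) y∈B))

    -- w ↦ u w + X sends 0, 1 to X, Y, and w ↦ u⁻¹ w − u⁻¹ X sends X, Y back to 0, 1.
    blocksThrough-constant : ∀ {x y} → x ≢ y →
      length (blocksThrough x y) ≡ length (blocksThrough (idx 0#) (idx 1#))
    blocksThrough-constant {x} {y} x≢y = ℕP.≤-antisym
      (blocksThrough-≤ u X u≢0 (sends 0# (trans (cong (_+ X) (zeroʳ u)) (+-identityˡ X)))
                               (sends 1# (trans (cong (_+ X) (*-identityʳ u)) (x-a+a≡x X Y))))
      (blocksThrough-≤ u⁻¹ (- (u⁻¹ * X)) u⁻¹≢0 (cong idx (-‿inverseʳ (u⁻¹ * X))) (cong idx u⁻¹Y-u⁻¹X≡1))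
      where
      X = elt x
      Y = elt y
      u = Y + - X
      u≢0 : u ≢ 0#
      u≢0 u≡0 = x≢y (trans (sym (idx∘elt x)) (trans (cong idx (sym (x-y≡0⇒x≡y Y X u≡0))) (idx∘elt y)))
      u⁻¹ = u ⁻¹[ u≢0 ]
      u⁻¹≢0 : u⁻¹ ≢ 0#
      u⁻¹≢0 u⁻¹≡0 = 1≢0 (trans (sym (x*x⁻¹≡1 u u≢0)) (trans (cong (u *_) u⁻¹≡0) (zeroʳ u)))
      u⁻¹Y-u⁻¹X≡1 : u⁻¹ * Y + - (u⁻¹ * X) ≡ 1#
      u⁻¹Y-u⁻¹X≡1 = begin
        u⁻¹ * Y + - (u⁻¹ * X)  ≡⟨ cong (u⁻¹ * Y +_) (-‿distribʳ-* u⁻¹ X) ⟩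
        u⁻¹ * Y + u⁻¹ * - X    ≡⟨ sym (distribˡ u⁻¹ Y (- X)) ⟩
        u⁻¹ * u                ≡⟨ x⁻¹*x≡1 u u≢0 ⟩
        1#                     ∎
      sends : ∀ a {v d w} → v * a + d ≡ elt w → idx (v * elt (idx a) + d) ≡ w
      sends a {v} {d} {w} va+d≡w = begin
        idx (v * elt (idx a) + d)  ≡⟨ cong (λ b → idx (v * b + d)) (elt∘idx a) ⟩
        idx (v * a + d)            ≡⟨ cong idx va+d≡w ⟩
        idx (elt w)                ≡⟨ idx∘elt w ⟩
        w                          ∎

    design : Is2Design q ℬ
    design = ℬ-unique
           , (i , All.tabulate (proj₂ ∘ ∈-ℬ⁻))
           , (length (blocksThrough (idx 0#) (idx 1#)) , λ x y → blocksThrough-constant)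

open import Data.Nat using (_^_)

theorem4 : (p m l : ℕ) → Prime p → p ≢ 2 → 2 ≤ m → 1 ≤ l → l ≤ m ∸ 1 → 1 < gcd m l →
    (𝔽 : FiniteField (p ^ m)) →
    (i : ℕ) → 1 ≤ i → Any (λ S → ∣ S ∣ ≡ i) (supportsD 𝔽 p m l) →
    Is2Design (p ^ m) (blocks 𝔽 p m l i)
theorem4 p m l p-prime _ _ _ l≤m-1 _ 𝔽 i _ _ =
  SupportDesign.Blocks.design 𝔽 p-prime (ℕP.≤-trans l≤m-1 (ℕP.m∸n≤m m 1)) i
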